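{- Consider the following translation of $\lambda\mathbf{J}$ into simply-typed $\lambda$-calculus. Types: $\overline{A}=\top\supset\neg\neg A^*$, $X^*=X$, $(A\supset B)^*=\overline{A}\supset\overline{B}$. Terms: $\overline{t}=\lambda gk.(t:g,k)$, $(x:G,K)=xGK$, $(\lambda x.t:G,K)=[K(\lambda x.\overline{t});G]$, $(t(u,x.v):G,K)=(t:G^+,\lambda m.(\lambda x.(v:G,K))(m\,\overline{u}))$. Then: (1) if $\Gamma\vdash t:A$ in $\lambda\mathbf{J}$ then $\overline{\Gamma}\vdash\overline{t}:\overline{A}$ in the simply-typed $\lambda$-calculus; (2) if $t\rightarrow u$ in $\lambda\mathbf{J}$, then $\overline{t}\rightarrow^+_\beta\overline{u}$.
   Context: $\lambda\mathbf{J}$: types $A::=X\mid A\supset B$; terms $t,u,v::=x\mid\lambda x.t\mid t(u,x.v)$ ($x$ bound in $v$). Typing: $\Gamma,x:A\vdash x:A$; from $\Gamma,x:A\vdash t:B$ infer $\Gamma\vdash\lambda x.t:A\supset B$; from $\Gamma\vdash t:A\supset B$, $\Gamma\vdash u:A$, $\Gamma,x:B\vdash v:C$ infer $\Gamma\vdash t(u,x.v):C$. A value $V$ is a variable or a $\lambda$-abstraction; generalised arguments $R,S$ are pairs $(u,x.v)$, $tRS=(tR)S$; $(u,x.V)@S=(u,x.VS)$, $(u,x.tR')@S=(u,x.t(R'@S))$. Reduction: closure under all constructors of $(\lambda x.t)(u,y.v)\rightarrow[[u/x]t/y]v$ and $tRS\rightarrow t(R@S)$. In the target: $\bot$ is a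 fixed type variable, $\neg A=A\supset\bot$, $\top$ is a fixed type and $\mathsf{s}:\top\supset\top$ a fixed closed term with $\mathsf{s}\,G\rightarrow^+_\beta G$ for all $G$ (e.g. $\mathsf{s}=\lambda z.z$), $G^+:=\mathsf{s}\,G$; $[t;u]:=(\lambda y.t)u$ with $y$ not free in $t$; $g,k,m$ fresh variables; $\overline{\Gamma}$ replaces each declaration $x:C$ of $\Gamma$ by $x:\overline{C}$. -}

module Defs where

open import Data.Nat using (ℕ; zero; suc)
open import Data.List using (List; []; _∷_; map)
open import Data.Product using (_×_; _,_)
open import Function using (_∘_; id)
open import Relation.Binary.Construct.Closure.Transitive using (TransClosure)

infixr 7 _⊃_
data Ty : Set where
  tvar : ℕ → Ty
  _⊃_  : Ty → Ty → Ty

Ctx : Set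
Ctx = List Ty

-- x : A ∈ Γ for de Bruijn index x (index 0 = last declared variable)
data _∋_∶_ : Ctx → ℕ → Ty → Set where
  here  : ∀ {Γ A} → (A ∷ Γ) ∋ zero ∶ A
  there : ∀ {Γ A B x} → Γ ∋ x ∶ A → (B ∷ Γ) ∋ suc x ∶ A

ext : (ℕ → ℕ) → (ℕ → ℕ)
ext ρ zero    = zero
ext ρ (suc i) = suc (ρ i)

data JTm : Set where
  var : ℕ → JTm
  lam : JTm → JTm
  app : JTm → JTm → JTm → JTm   -- app t u v  =  t(u, x.v), v under one binder

renJ : (ℕ → ℕ) → JTm → JTm
renJ ρ (var x)     = var (ρ x)
renJ ρ (lam t)     = lam (renJ (ext ρ) t)
renJ ρ (app t u v) = app (renJ ρ t) (renJ ρ u) (renJ (ext ρ) v)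

extsJ : (ℕ → JTm) → (ℕ → JTm)
extsJ σ zero    = var zero
extsJ σ (suc i) = renJ suc (σ i)

subJ : (ℕ → JTm) → JTm → JTm
subJ σ (var x)     = σ x
subJ σ (lam t)     = lam (subJ (extsJ σ) t)
subJ σ (app t u v) = app (subJ σ t) (subJ σ u) (subJ (extsJ σ) v)

sub1J : JTm → (ℕ → JTm)
sub1J u zero    = u
sub1J u (suc i) = var i

_[_]J : JTm → JTm → JTm
t [ u ]J = subJ (sub1J u) t

data _⊢J_∶_ : Ctx → JTm → Ty → Set where
  ax  : ∀ {Γ x A} → Γ ∋ x ∶ A → Γ ⊢J var x ∶ A
  abs : ∀ {Γ t A B} → (A ∷ Γ) ⊢J t ∶ B → Γ ⊢J lam t ∶ (A ⊃ B)
  gap : ∀ {Γ t u v A B C} → Γ ⊢J t ∶ (A ⊃ B) → Γ ⊢J u ∶ A → (B ∷ Γ) ⊢J v ∶ C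
      → Γ ⊢J app t u v ∶ C

-- Appending a generalised argument S = (a, y.b) to the body v of a
-- generalised argument (u, x.v):  (u,x.v)@S = (u, x. v ⊕ S) where
--   V ⊕ S = V S            (V a value)
--   (t R') ⊕ S = t (R'@S)
-- Here a, b live in the same scope as v (i.e. already weakened past x).
_⊕_,_ : JTm → JTm → JTm → JTm
var x ⊕ a , b         = app (var x) a b
lam t ⊕ a , b         = app (lam t) a b
app t u₁ v₁ ⊕ a , b   = app t u₁ (v₁ ⊕ renJ suc a , renJ (ext suc) b)

-- (u, x.v) @ (a, y.b) = (u, x. v ⊕ (a, y.b) weakened under x)
-- so  t R S → t (R @ S)  becomes the rule `π` below.

data _→J_ : JTm → JTm → Set where
  β    : ∀ {t u v} → app (lam t) u v →J (v [ t [ u ]J ]J)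
  π    : ∀ {t u v a b} →
         app (app t u v) a b →J app t u (v ⊕ renJ suc a , renJ (ext suc) b)
  ξlam : ∀ {t t'} → t →J t' → lam t →J lam t'
  ξ₁   : ∀ {t t' u v} → t →J t' → app t u v →J app t' u v
  ξ₂   : ∀ {t u u' v} → u →J u' → app t u v →J app t u' v
  ξ₃   : ∀ {t u v v'} → v →J v' → app t u v →J app t u v'

data Tm : Set where
  var : ℕ → Tm
  lam : Tm → Tm
  _·_ : Tm → Tm → Tm

infixl 9 _·_

ren : (ℕ → ℕ) → Tm → Tm
ren ρ (var x) = var (ρ x)
ren ρ (lam t) = lam (ren (ext ρ) t)
ren ρ (t · u) = ren ρ t · ren ρ u

exts : (ℕ → Tm) → (ℕ → Tm)
exts σ zero    = var zero
exts σ (suc i) = ren suc (σ i)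

sub : (ℕ → Tm) → Tm → Tm
sub σ (var x) = σ x
sub σ (lam t) = lam (sub (exts σ) t)
sub σ (t · u) = sub σ t · sub σ u

sub1 : Tm → (ℕ → Tm)
sub1 u zero    = u
sub1 u (suc i) = var i

_[_] : Tm → Tm → Tm
t [ u ] = sub (sub1 u) t

data _⊢_∶_ : Ctx → Tm → Ty → Set where
  ax  : ∀ {Γ x A} → Γ ∋ x ∶ A → Γ ⊢ var x ∶ A
  abs : ∀ {Γ t A B} → (A ∷ Γ) ⊢ t ∶ B → Γ ⊢ lam t ∶ (A ⊃ B)
  ap  : ∀ {Γ t u A B} → Γ ⊢ t ∶ (A ⊃ B) → Γ ⊢ u ∶ A → Γ ⊢ t · u ∶ B

data _→β_ : Tm → Tm → Set where
  β    : ∀ {t u} → (lam t · u) →β (t [ u ])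
  ξlam : ∀ {t t'} → t →β t' → lam t →β lam t'
  ξ₁   : ∀ {t t' u} → t →β t' → (t · u) →β (t' · u)
  ξ₂   : ∀ {t u u'} → u →β u' → (t · u) →β (t · u')

_→β⁺_ : Tm → Tm → Set
_→β⁺_ = TransClosure _→β_

-- The translation.  Parameters: ⊥ is a fixed type variable (index `bot`),
-- ⊤ a fixed type `top`, and s a fixed term (hypotheses on s are in the
-- theorem statement).

¬[_]_ : ℕ → Ty → Ty
¬[ bot ] A = A ⊃ tvar bot

mutual
  tyBar : ℕ → Ty → Ty → Ty
  tyBar bot top A = top ⊃ ¬[ bot ] (¬[ bot ] (tyStar bot top A))

  tyStar : ℕ → Ty → Ty → Ty
  tyStar bot top (tvar X) = tvar X
  tyStar bot top (A ⊃ B)  = tyBar bot top A ⊃ tyBar bot top B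

ctxBar : ℕ → Ty → Ctx → Ctx
ctxBar bot top = map (tyBar bot top)

[_⨾_] : Tm → Tm → Tm
[ t ⨾ u ] = lam (ren suc t) · u

-- Terms.  The renaming ρ maps the free variables of the source term to
-- target variables (needed to go under the fresh binders g, k, m with
-- de Bruijn indices).
mutual
  barR : Tm → (ℕ → ℕ) → JTm → Tm
  barR s ρ t = lam (lam (colon s (suc ∘ suc ∘ ρ) t (var 1) (var 0)))

  colon : Tm → (ℕ → ℕ) → JTm → Tm → Tm → Tm
  colon s ρ (var x) G K = var (ρ x) · G · K
  colon s ρ (lam t) G K = [ K · lam (barR s (ext ρ) t) ⨾ G ]
  -- (t(u,x.v) : G, K) = (t : G⁺, λm. (λx.(v : G, K)) (m ū)),  G⁺ = s G
  colon s ρ (app t u v) G K =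
    colon s ρ t (s · G)
      (lam (lam (colon s (ext (suc ∘ ρ)) v (ren (suc ∘ suc) G) (ren (suc ∘ suc) K))
            · (var 0 · barR s (suc ∘ ρ) u)))

bar : Tm → JTm → Tm
bar s t = barR s id t

-- (t : G, K) is typed ⊥ whenever G : ⊤ and K : ¬A*, which makes typing a
-- clause-by-clause check.  For simulation the key fact is that the translation
-- commutes with substitution up to β, provided each substituted variable is
-- realised by a variable or by the translation ū of a term.  A λJ β-step then
-- becomes the administrative redexes of [K(λx.t̄); G⁺] followed by two such
-- substitutions, and a π-step becomes G⁺⁺ →⁺ G⁺ (the only use of s) followed by
-- reassociating the nested continuations.

module Submission where

open import Defs
open import Data.Nat using (ℕ; zero; suc)
open import Data.List using ([]; _∷_)
open import Data.Product using (_×_; _,_)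
open import Function using (_∘_; id)
open import Relation.Binary.PropositionalEquality
open import Relation.Binary.Construct.Closure.Transitive using ([_]; _∷_; _∷ʳ_; _++_)
open import Relation.Binary.Construct.Closure.ReflexiveTransitive using (Star; ε; _◅_; _◅◅_; gmap; kleisliStar)

ren-ren : ∀ {f g h : ℕ → ℕ} → f ∘ g ≗ h → ∀ t → ren f (ren g t) ≡ ren h t
ren-ren e (var x) = cong var (e x)
ren-ren {f} {g} {h} e (lam t) = cong lam (ren-ren ext-ext t)
  where
  ext-ext : ext f ∘ ext g ≗ ext h
  ext-ext zero    = refl
  ext-ext (suc x) = cong suc (e x)
ren-ren e (t · u) = cong₂ _·_ (ren-ren e t) (ren-ren e u)

sub-ren : ∀ {σ τ : ℕ → Tm} {f} → σ ∘ f ≗ τ → ∀ t → sub σ (ren f t) ≡ sub τ t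
sub-ren e (var x) = e x
sub-ren {σ} {τ} {f} e (lam t) = cong lam (sub-ren exts-ext t)
  where
  exts-ext : exts σ ∘ ext f ≗ exts τ
  exts-ext zero    = refl
  exts-ext (suc x) = cong (ren suc) (e x)
sub-ren e (t · u) = cong₂ _·_ (sub-ren e t) (sub-ren e u)

ren-sub : ∀ {f} {σ τ : ℕ → Tm} → ren f ∘ σ ≗ τ → ∀ t → ren f (sub σ t) ≡ sub τ t
ren-sub e (var x) = e x
ren-sub {f} {σ} {τ} e (lam t) = cong lam (ren-sub ext-exts t)
  where
  ext-exts : ren (ext f) ∘ exts σ ≗ exts τ
  ext-exts zero    = refl
  ext-exts (suc x) = begin
    ren (ext f) (ren suc (σ x)) ≡⟨ ren-ren (λ _ → refl) (σ x) ⟩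
    ren (suc ∘ f) (σ x)         ≡⟨ ren-ren (λ _ → refl) (σ x) ⟨
    ren suc (ren f (σ x))       ≡⟨ cong (ren suc) (e x) ⟩
    ren suc (τ x)               ∎
    where open ≡-Reasoning
ren-sub e (t · u) = cong₂ _·_ (ren-sub e t) (ren-sub e u)

sub-id : ∀ {σ} → σ ≗ var → ∀ t → sub σ t ≡ t
sub-id e (var x) = e x
sub-id {σ} e (lam t) = cong lam (sub-id exts-id t)
  where
  exts-id : exts σ ≗ var
  exts-id zero    = refl
  exts-id (suc x) = cong (ren suc) (e x)
sub-id e (t · u) = cong₂ _·_ (sub-id e t) (sub-id e u)

ren-as-sub : ∀ f t → ren f t ≡ sub (var ∘ f) t
ren-as-sub f t = trans (sym (sub-id (λ _ → refl) (ren f t))) (sub-ren (λ _ → refl) t)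

sub-ren-as-ren : ∀ {σ f g} → (∀ x → σ (f x) ≡ var (g x)) → ∀ t → sub σ (ren f t) ≡ ren g t
sub-ren-as-ren e t = trans (sub-ren e t) (sym (ren-as-sub _ t))

sub1-weaken : ∀ w t → sub (sub1 w) (ren suc t) ≡ t
sub1-weaken w t = trans (sub-ren (λ _ → refl) t) (sub-id (λ _ → refl) t)

sub-exts-weaken : ∀ σ t → sub (exts σ) (ren suc t) ≡ ren suc (sub σ t)
sub-exts-weaken σ t = trans (sub-ren (λ _ → refl) t) (sym (ren-sub (λ _ → refl) t))

sub-exts²-weaken² : ∀ σ t → sub (exts (exts σ)) (ren (suc ∘ suc) t) ≡ ren (suc ∘ suc) (sub σ t)
sub-exts²-weaken² σ t =
  trans (sub-ren (λ _ → refl) t) (sym (ren-sub (λ x → sym (ren-ren (λ _ → refl) (σ x))) t))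

sub-seq : ∀ σ t u → sub σ [ t ⨾ u ] ≡ [ sub σ t ⨾ sub σ u ]
sub-seq σ t u = cong (λ z → lam z · sub σ u) (sub-exts-weaken σ t)

Renaming : (ℕ → ℕ) → Ctx → Ctx → Set
Renaming ρ Γ Δ = ∀ {x B} → Γ ∋ x ∶ B → Δ ∋ ρ x ∶ B

Renaming-ext : ∀ {ρ Γ Δ A} → Renaming ρ Γ Δ → Renaming (ext ρ) (A ∷ Γ) (A ∷ Δ)
Renaming-ext h here      = here
Renaming-ext h (there i) = there (h i)

ren-⊢ : ∀ {Γ Δ t A ρ} → Γ ⊢ t ∶ A → Renaming ρ Γ Δ → Δ ⊢ ren ρ t ∶ A
ren-⊢ (ax i)   h = ax (h i)
ren-⊢ (abs d)  h = abs (ren-⊢ d (Renaming-ext h))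
ren-⊢ (ap d e) h = ap (ren-⊢ d h) (ren-⊢ e h)

sub-fixing-scope : ∀ {Γ t A σ} → Γ ⊢ t ∶ A → (∀ {x B} → Γ ∋ x ∶ B → σ x ≡ var x) → sub σ t ≡ t
sub-fixing-scope (ax i)  h = h i
sub-fixing-scope {σ = σ} (abs d) h = cong lam (sub-fixing-scope d exts-fixes)
  where
  exts-fixes : ∀ {x B} → _ ∋ x ∶ B → exts σ x ≡ var x
  exts-fixes here      = refl
  exts-fixes (there i) = cong (ren suc) (h i)
sub-fixing-scope (ap d e) h = cong₂ _·_ (sub-fixing-scope d h) (sub-fixing-scope e h)

closed-sub : ∀ {t A} → [] ⊢ t ∶ A → ∀ σ → sub σ t ≡ t
closed-sub d σ = sub-fixing-scope d (λ ())

closed-weaken : ∀ {Δ t A} → [] ⊢ t ∶ A → Δ ⊢ t ∶ A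
closed-weaken {Δ} {t} {A} d =
  subst (λ z → Δ ⊢ z ∶ A) (trans (ren-as-sub id t) (closed-sub d _)) (ren-⊢ d (λ ()))

ren-→β : ∀ {t t'} f → t →β t' → ren f t →β ren f t'
ren-→β f (β {t} {u}) = subst ((lam (ren (ext f) t) · ren f u) →β_) sub1-ren β
  where
  sub1-ext : ∀ x → sub1 (ren f u) (ext f x) ≡ ren f (sub1 u x)
  sub1-ext zero    = refl
  sub1-ext (suc x) = refl
  sub1-ren : sub (sub1 (ren f u)) (ren (ext f) t) ≡ ren f (sub (sub1 u) t)
  sub1-ren = trans (sub-ren sub1-ext t) (sym (ren-sub (λ _ → refl) t))
ren-→β f (ξlam r) = ξlam (ren-→β (ext f) r)
ren-→β f (ξ₁ r)   = ξ₁ (ren-→β f r)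
ren-→β f (ξ₂ r)   = ξ₂ (ren-→β f r)

seq-β : ∀ t u → [ t ⨾ u ] →β t
seq-β t u = subst ([ t ⨾ u ] →β_) (sub1-weaken u t) β

seq-congˡ : ∀ {t t' u} → t →β t' → [ t ⨾ u ] →β [ t' ⨾ u ]
seq-congˡ r = ξ₁ (ξlam (ren-→β suc r))

infix 4 _→β*_
_→β*_ : Tm → Tm → Set
_→β*_ = Star _→β_

≡⇒→β* : ∀ {a b} → a ≡ b → a →β* b
≡⇒→β* refl = ε

→β⁺⇒→β* : ∀ {a b} → a →β⁺ b → a →β* b
→β⁺⇒→β* [ r ]   = r ◅ ε
→β⁺⇒→β* (r ∷ p) = r ◅ →β⁺⇒→β* p

infixr 5 _⁺◅◅_
_⁺◅◅_ : ∀ {a b c} → a →β⁺ b → b →β* c → a →β⁺ c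
p ⁺◅◅ ε       = p
p ⁺◅◅ (r ◅ q) = (p ∷ʳ r) ⁺◅◅ q

map⁺ : ∀ (f : Tm → Tm) → (∀ {a b} → a →β b → f a →β f b)
     → ∀ {a b} → a →β⁺ b → f a →β⁺ f b
map⁺ f g [ r ]   = [ g r ]
map⁺ f g (r ∷ p) = g r ∷ map⁺ f g p

bind⁺ : ∀ (f : Tm → Tm) → (∀ {a b} → a →β b → f a →β⁺ f b)
      → ∀ {a b} → a →β⁺ b → f a →β⁺ f b
bind⁺ f g [ r ]   = g r
bind⁺ f g (r ∷ p) = g r ++ bind⁺ f g p

∋-ctxBar : ∀ {bot top Γ x B} → Γ ∋ x ∶ B → ctxBar bot top Γ ∋ x ∶ tyBar bot top B
∋-ctxBar here      = here
∋-ctxBar (there i) = there (∋-ctxBar i)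

κ : Tm → Tm → Tm
κ C B = lam (lam C · (var 0 · B))

κ-congˡ : ∀ {C C' B} → C →β C' → κ C B →β κ C' B
κ-congˡ r = ξlam (ξ₁ (ξlam r))

κ-congʳ : ∀ {C B B'} → B →β B' → κ C B →β κ C B'
κ-congʳ r = ξlam (ξ₂ (ξ₂ r))

module Typing (bot : ℕ) (top : Ty) (s : Tm) (s-⊢ : ∀ {Δ} → Δ ⊢ s ∶ (top ⊃ top)) where

  mutual
    colon-⊢ : ∀ {Γ Δ t A ρ G K} → Γ ⊢J t ∶ A → Renaming ρ (ctxBar bot top Γ) Δ
      → Δ ⊢ G ∶ top → Δ ⊢ K ∶ (tyStar bot top A ⊃ tvar bot)
      → Δ ⊢ colon s ρ t G K ∶ tvar bot
    colon-⊢ (ax i) h g k = ap (ap (ax (h (∋-ctxBar i))) g) k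
    colon-⊢ (abs d) h g k = ap (abs (ren-⊢ (ap k (abs (bar-⊢ d (Renaming-ext h)))) there)) g
    colon-⊢ (gap d e f) h g k =
      colon-⊢ d h (ap s-⊢ g)
        (abs (ap (abs (colon-⊢ f (Renaming-ext (λ i → there (h i)))
                                 (ren-⊢ g (λ i → there (there i))) (ren-⊢ k (λ i → there (there i)))))
                 (ap (ax here) (bar-⊢ e (λ i → there (h i))))))

    bar-⊢ : ∀ {Γ Δ t A ρ} → Γ ⊢J t ∶ A → Renaming ρ (ctxBar bot top Γ) Δ
      → Δ ⊢ barR s ρ t ∶ tyBar bot top A
    bar-⊢ d h = abs (abs (colon-⊢ d (λ i → there (there (h i))) (ax (there here)) (ax here)))

module Translation (s : Tm) (s-closed : ∀ σ → sub σ s ≡ s) where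

  cont : (ℕ → ℕ) → Tm → Tm → JTm → JTm → Tm
  cont ρ G K u v =
    κ (colon s (ext (suc ∘ ρ)) v (ren (suc ∘ suc) G) (ren (suc ∘ suc) K)) (barR s (suc ∘ ρ) u)

  ren-closed : ∀ f → ren f s ≡ s
  ren-closed f = trans (ren-as-sub f s) (s-closed _)

  record RenamesAs (σ : ℕ → Tm) (ρ ρ' : ℕ → ℕ) : Set where
    constructor renamesAs
    field at : ∀ x → σ (ρ x) ≡ var (ρ' x)
  open RenamesAs

  RenamesAs-ext : ∀ {σ ρ ρ'} → RenamesAs σ ρ ρ' → RenamesAs (exts σ) (ext ρ) (ext ρ')
  RenamesAs-ext h = renamesAs λ { zero → refl ; (suc x) → cong (ren suc) (at h x) }

  RenamesAs-suc : ∀ {σ ρ ρ'} → RenamesAs σ ρ ρ' → RenamesAs (exts σ) (suc ∘ ρ) (suc ∘ ρ')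
  RenamesAs-suc h = renamesAs λ x → cong (ren suc) (at h x)

  mutual
    sub-colon : ∀ {σ ρ ρ'} → RenamesAs σ ρ ρ' → ∀ t G K →
      sub σ (colon s ρ t G K) ≡ colon s ρ' t (sub σ G) (sub σ K)
    sub-colon {σ} h (var x) G K = cong (λ z → z · sub σ G · sub σ K) (at h x)
    sub-colon {σ} {ρ} h (lam t) G K =
      trans (sub-seq σ (K · lam (barR s (ext ρ) t)) G)
            (cong (λ z → [ sub σ K · lam z ⨾ sub σ G ]) (sub-bar (RenamesAs-ext h) t))
    sub-colon {σ} {ρ} {ρ'} h (app t u v) G K =
      trans (sub-colon h t (s · G) (cont ρ G K u v))
            (cong₂ (λ z K' → colon s ρ' t (z · sub σ G) K') (s-closed σ) (sub-cont h G K u v))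

    sub-cont : ∀ {σ ρ ρ'} → RenamesAs σ ρ ρ' → ∀ G K u v →
      sub σ (cont ρ G K u v) ≡ cont ρ' (sub σ G) (sub σ K) u v
    sub-cont {σ} {ρ} {ρ'} h G K u v =
      cong₂ κ (trans (sub-colon (RenamesAs-ext (RenamesAs-suc h)) v _ _)
                     (cong₂ (colon s (ext (suc ∘ ρ')) v) (sub-exts²-weaken² σ G) (sub-exts²-weaken² σ K)))
              (sub-bar (RenamesAs-suc h) u)

    sub-bar : ∀ {σ ρ ρ'} → RenamesAs σ ρ ρ' → ∀ t → sub σ (barR s ρ t) ≡ barR s ρ' t
    sub-bar h t = cong (λ z → lam (lam z)) (sub-colon (RenamesAs-suc (RenamesAs-suc h)) t (var 1) (var 0))

  ren-bar : ∀ {ξ ρ ρ'} → ξ ∘ ρ ≗ ρ' → ∀ t → ren ξ (barR s ρ t) ≡ barR s ρ' t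
  ren-bar {ξ} h t = trans (ren-as-sub ξ _) (sub-bar (renamesAs (cong var ∘ h)) t)

  ren-cont : ∀ {ξ ρ} G K u v → ren ξ (cont ρ G K u v) ≡ cont (ξ ∘ ρ) (ren ξ G) (ren ξ K) u v
  ren-cont {ξ} G K u v =
    trans (ren-as-sub ξ _)
          (trans (sub-cont (renamesAs (λ _ → refl)) G K u v)
                 (sym (cong₂ (λ G' K' → cont _ G' K' u v) (ren-as-sub ξ G) (ren-as-sub ξ K))))

  mutual
    colon-renJ : ∀ {ζ ρ ρ'} → ρ ∘ ζ ≗ ρ' → ∀ t G K → colon s ρ (renJ ζ t) G K ≡ colon s ρ' t G K
    colon-renJ h (var x) G K = cong (λ z → var z · G · K) (h x)
    colon-renJ {ζ} {ρ} {ρ'} h (lam t) G K =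
      cong (λ z → [ K · lam z ⨾ G ]) (bar-renJ ext-ext t)
      where
      ext-ext : ext ρ ∘ ext ζ ≗ ext ρ'
      ext-ext zero    = refl
      ext-ext (suc x) = cong suc (h x)
    colon-renJ h (app t u v) G K =
      trans (colon-renJ h t (s · G) _) (cong (colon s _ t (s · G)) (cont-renJ h G K u v))

    cont-renJ : ∀ {ζ ρ ρ'} → ρ ∘ ζ ≗ ρ' → ∀ G K u v →
      cont ρ G K (renJ ζ u) (renJ (ext ζ) v) ≡ cont ρ' G K u v
    cont-renJ {ζ} {ρ} {ρ'} h G K u v =
      cong₂ κ (colon-renJ ext-ext v _ _) (bar-renJ (cong suc ∘ h) u)
      where
      ext-ext : ext (suc ∘ ρ) ∘ ext ζ ≗ ext (suc ∘ ρ')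
      ext-ext zero    = refl
      ext-ext (suc x) = cong (suc ∘ suc) (h x)

    bar-renJ : ∀ {ζ ρ ρ'} → ρ ∘ ζ ≗ ρ' → ∀ t → barR s ρ (renJ ζ t) ≡ barR s ρ' t
    bar-renJ {ζ} {ρ} {ρ'} h t =
      cong (λ z → lam (lam z))
        (colon-renJ {ζ} {suc ∘ suc ∘ ρ} {suc ∘ suc ∘ ρ'} (cong (suc ∘ suc) ∘ h) t (var 1) (var 0))

  mutual
    K-cong : ∀ ρ t G {K K'} → K →β K' → colon s ρ t G K →β⁺ colon s ρ t G K'
    K-cong ρ (var x) G r = [ ξ₂ r ]
    K-cong ρ (lam t) G r = [ seq-congˡ (ξ₁ r) ]
    K-cong ρ (app t u v) G r =
      K-cong⁺ ρ t (s · G)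
        (map⁺ (λ C → κ C (barR s (suc ∘ ρ) u)) κ-congˡ
              (K-cong (ext (suc ∘ ρ)) v _ (ren-→β (suc ∘ suc) r)))

    K-cong⁺ : ∀ ρ t G {K K'} → K →β⁺ K' → colon s ρ t G K →β⁺ colon s ρ t G K'
    K-cong⁺ ρ t G = bind⁺ (colon s ρ t G) (K-cong ρ t G)

  K-cong* : ∀ ρ t G {K K'} → K →β* K' → colon s ρ t G K →β* colon s ρ t G K'
  K-cong* ρ t G = kleisliStar (colon s ρ t G) (λ r → →β⁺⇒→β* (K-cong ρ t G r))

  G-cong : ∀ ρ t K {G G'} → G →β G' → colon s ρ t G K →β⁺ colon s ρ t G' K
  G-cong ρ (var x) K r = [ ξ₁ (ξ₂ r) ]
  G-cong ρ (lam t) K r = [ ξ₂ r ]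
  G-cong ρ (app t u v) K {G} {G'} r =
    G-cong ρ t (cont ρ G K u v) (ξ₂ r) ++
    K-cong⁺ ρ t (s · G')
      (map⁺ (λ C → κ C (barR s (suc ∘ ρ) u)) κ-congˡ
            (G-cong (ext (suc ∘ ρ)) v _ (ren-→β (suc ∘ suc) r)))

  G-cong⁺ : ∀ ρ t K {G G'} → G →β⁺ G' → colon s ρ t G K →β⁺ colon s ρ t G' K
  G-cong⁺ ρ t K = bind⁺ (λ G → colon s ρ t G K) (G-cong ρ t K)

  data Realises (ρ : ℕ → ℕ) : JTm → Tm → Set where
    var : ∀ y → Realises ρ (var y) (var (ρ y))
    barred : ∀ t → Realises ρ t (barR s ρ t)

  record Realising (σ : ℕ → Tm) (ρ ρ' : ℕ → ℕ) (τ : ℕ → JTm) : Set where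
    constructor realising
    field realises : ∀ x → Realises ρ' (τ x) (σ (ρ x))
  open Realising

  Realises-weaken : ∀ {ρ a w} → Realises ρ a w → Realises (suc ∘ ρ) a (ren suc w)
  Realises-weaken (var y) = var y
  Realises-weaken {ρ} (barred t) = subst (Realises (suc ∘ ρ) t) (sym (ren-bar (λ _ → refl) t)) (barred t)

  Realises-ext : ∀ {ρ a w} → Realises ρ a w → Realises (ext ρ) (renJ suc a) (ren suc w)
  Realises-ext (var y) = var (suc y)
  Realises-ext {ρ} (barred t) =
    subst (Realises (ext ρ) (renJ suc t))
          (trans (bar-renJ (λ _ → refl) t) (sym (ren-bar (λ _ → refl) t)))
          (barred (renJ suc t))

  Realising-suc : ∀ {σ ρ ρ' τ} → Realising σ ρ ρ' τ → Realising (exts σ) (suc ∘ ρ) (suc ∘ ρ') τ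
  Realising-suc g = realising λ x → Realises-weaken (realises g x)

  Realising-ext : ∀ {σ ρ ρ' τ} → Realising σ ρ ρ' τ → Realising (exts σ) (ext ρ) (ext ρ') (extsJ τ)
  Realising-ext g = realising λ { zero → var zero ; (suc x) → Realises-ext (realises g x) }

  Realising-sub1 : ∀ ρ a → Realising (sub1 (barR s ρ a)) (ext ρ) ρ (sub1J a)
  Realising-sub1 ρ a = realising λ { zero → barred a ; (suc x) → var x }

  bar-app : ∀ ρ t G K → barR s ρ t · G · K →β* colon s ρ t G K
  bar-app ρ t G K = ξ₁ β ◅ β ◅ ≡⇒→β* (begin
    sub (sub1 K) (sub (exts (sub1 G)) (colon s (suc ∘ suc ∘ ρ) t (var 1) (var 0)))
      ≡⟨ cong (sub (sub1 K)) (sub-colon (renamesAs (λ _ → refl)) t (var 1) (var 0)) ⟩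
    sub (sub1 K) (colon s (suc ∘ ρ) t (ren suc G) (var 0))
      ≡⟨ sub-colon (renamesAs (λ _ → refl)) t (ren suc G) (var 0) ⟩
    colon s ρ t (sub (sub1 K) (ren suc G)) K
      ≡⟨ cong (λ G' → colon s ρ t G' K) (sub1-weaken K G) ⟩
    colon s ρ t G K ∎)
    where open ≡-Reasoning

  Realises-app : ∀ {ρ a w} → Realises ρ a w → ∀ G K → w · G · K →β* colon s ρ a G K
  Realises-app (var y) G K = ε
  Realises-app (barred t) G K = bar-app _ t G K

  mutual
    sub-colon* : ∀ {σ ρ ρ' τ} → Realising σ ρ ρ' τ → ∀ t G K →
      sub σ (colon s ρ t G K) →β* colon s ρ' (subJ τ t) (sub σ G) (sub σ K)
    sub-colon* g (var x) G K = Realises-app (realises g x) _ _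
    sub-colon* {σ} {ρ} g (lam t) G K =
      ≡⇒→β* (sub-seq σ (K · lam (barR s (ext ρ) t)) G)
      ◅◅ gmap (λ z → [ sub σ K · lam z ⨾ sub σ G ]) (λ r → seq-congˡ (ξ₂ (ξlam r)))
              (sub-bar* (Realising-ext g) t)
    sub-colon* {σ} {ρ} {ρ'} {τ} g (app t u v) G K =
      sub-colon* g t (s · G) (cont ρ G K u v)
      ◅◅ ≡⇒→β* (cong (λ z → colon s ρ' (subJ τ t) (z · sub σ G) (sub σ (cont ρ G K u v))) (s-closed σ))
      ◅◅ K-cong* ρ' (subJ τ t) (s · sub σ G) (sub-cont* g G K u v)

    sub-cont* : ∀ {σ ρ ρ' τ} → Realising σ ρ ρ' τ → ∀ G K u v →
      sub σ (cont ρ G K u v) →β* cont ρ' (sub σ G) (sub σ K) (subJ τ u) (subJ (extsJ τ) v)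
    sub-cont* {σ} {ρ} {ρ'} {τ} g G K u v =
      gmap (λ C → κ C (sub (exts σ) (barR s (suc ∘ ρ) u))) κ-congˡ
           (sub-colon* (Realising-ext (Realising-suc g)) v _ _
            ◅◅ ≡⇒→β* (cong₂ (colon s (ext (suc ∘ ρ')) (subJ (extsJ τ) v))
                            (sub-exts²-weaken² σ G) (sub-exts²-weaken² σ K)))
      ◅◅ gmap (κ _) κ-congʳ (sub-bar* (Realising-suc g) u)

    sub-bar* : ∀ {σ ρ ρ' τ} → Realising σ ρ ρ' τ → ∀ t → sub σ (barR s ρ t) →β* barR s ρ' (subJ τ t)
    sub-bar* g t =
      gmap (λ z → lam (lam z)) (λ r → ξlam (ξlam r))
           (sub-colon* (Realising-suc (Realising-suc g)) t (var 1) (var 0))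

  bar-β : ∀ ρ t u → (lam (barR s (ext ρ) t) · barR s ρ u) →β⁺ barR s ρ (t [ u ]J)
  bar-β ρ t u = [ β ] ⁺◅◅ sub-bar* (Realising-sub1 ρ u) t

  colon-β-sub1 : ∀ ρ v a G K →
    (lam (colon s (ext ρ) v (ren suc G) (ren suc K)) · barR s ρ a) →β⁺ colon s ρ (v [ a ]J) G K
  colon-β-sub1 ρ v a G K =
    [ β ] ⁺◅◅ sub-colon* (Realising-sub1 ρ a) v _ _
          ◅◅ ≡⇒→β* (cong₂ (colon s ρ (v [ a ]J)) (sub1-weaken _ G) (sub1-weaken _ K))

  cont-β : ∀ ρ G K u v w →
    (cont ρ G K u v · w) →β (lam (colon s (ext ρ) v (ren suc G) (ren suc K)) · (w · barR s ρ u))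
  cont-β ρ G K u v w = subst ((cont ρ G K u v · w) →β_) sub1-cont β
    where
    exts-sub1 : ∀ x → exts (sub1 w) (ext (suc ∘ ρ) x) ≡ var (ext ρ x)
    exts-sub1 zero    = refl
    exts-sub1 (suc x) = refl
    sub1-cont : sub (sub1 w) (lam (colon s (ext (suc ∘ ρ)) v (ren (suc ∘ suc) G) (ren (suc ∘ suc) K))
                                · (var 0 · barR s (suc ∘ ρ) u))
              ≡ lam (colon s (ext ρ) v (ren suc G) (ren suc K)) · (w · barR s ρ u)
    sub1-cont =
      cong₂ (λ C B → lam C · (w · B))
        (trans (sub-colon (renamesAs exts-sub1) v _ _)
               (cong₂ (colon s (ext ρ) v) (sub-ren-as-ren (λ _ → refl) G) (sub-ren-as-ren (λ _ → refl) K)))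
        (sub-bar (renamesAs (λ _ → refl)) u)

  module Simulation (s-shrinks : ∀ G → (s · G) →β⁺ G) where

    colon-β : ∀ ρ t u v G K → colon s ρ (app (lam t) u v) G K →β⁺ colon s ρ (v [ t [ u ]J ]J) G K
    colon-β ρ t u v G K =
      seq-β (cont ρ G K u v · lam (barR s (ext ρ) t)) (s · G)
      ∷ cont-β ρ G K u v (lam (barR s (ext ρ) t))
      ∷ map⁺ (lam (colon s (ext ρ) v (ren suc G) (ren suc K)) ·_) ξ₂ (bar-β ρ t u)
      ++ colon-β-sub1 ρ v (t [ u ]J) G K

    mutual
      colon-⊕ : ∀ ρ v G K a b → colon s ρ v (s · G) (cont ρ G K a b) →β* colon s ρ (v ⊕ a , b) G K
      colon-⊕ ρ (var x)     G K a b = ε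
      colon-⊕ ρ (lam t)     G K a b = ε
      colon-⊕ ρ (app t u v) G K a b = →β⁺⇒→β* (colon-π ρ t u v G K a b)

      -- The inner continuation, renamed under m and x, has the shape cont ρ' G' K' a' b'.
      cont-π : ∀ ρ G K u v a b →
        cont ρ (s · G) (cont ρ G K a b) u v →β* cont ρ G K u (v ⊕ renJ suc a , renJ (ext suc) b)
      cont-π ρ G K u v a b =
        gmap (λ C → κ C (barR s (suc ∘ ρ) u)) κ-congˡ
          (≡⇒→β* (cong₂ (colon s (ext (suc ∘ ρ)) v)
                        (cong (_· ren (suc ∘ suc) G) (ren-closed (suc ∘ suc)))
                        (trans (ren-cont G K a b) (sym (cont-renJ (λ _ → refl) _ _ a b))))
           ◅◅ colon-⊕ (ext (suc ∘ ρ)) v _ _ _ _)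

      colon-π : ∀ ρ t u v G K a b →
        colon s ρ (app (app t u v) a b) G K →β⁺ colon s ρ (app t u (v ⊕ renJ suc a , renJ (ext suc) b)) G K
      colon-π ρ t u v G K a b =
        G-cong⁺ ρ t _ (s-shrinks (s · G)) ⁺◅◅ K-cong* ρ t (s · G) (cont-π ρ G K u v a b)

    mutual
      colon-step : ∀ {t t'} → t →J t' → ∀ ρ G K → colon s ρ t G K →β⁺ colon s ρ t' G K
      colon-step (β {t} {u} {v})           ρ G K = colon-β ρ t u v G K
      colon-step (π {t} {u} {v} {a} {b})   ρ G K = colon-π ρ t u v G K a b
      colon-step (ξlam r)                  ρ G K =
        map⁺ (λ z → [ K · lam z ⨾ G ]) (λ q → seq-congˡ (ξ₂ (ξlam q))) (bar-step r (ext ρ))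
      colon-step (ξ₁ {u = u} {v} r)        ρ G K = colon-step r ρ (s · G) (cont ρ G K u v)
      colon-step (ξ₂ {t} {u} {u'} {v} r)   ρ G K =
        K-cong⁺ ρ t (s · G) (map⁺ (κ _) κ-congʳ (bar-step r (suc ∘ ρ)))
      colon-step (ξ₃ {t} {u} {v} {v'} r)   ρ G K =
        K-cong⁺ ρ t (s · G)
          (map⁺ (λ C → κ C (barR s (suc ∘ ρ) u)) κ-congˡ (colon-step r _ _ _))

      bar-step : ∀ {t t'} → t →J t' → ∀ ρ → barR s ρ t →β⁺ barR s ρ t'
      bar-step r ρ = map⁺ (λ z → lam (lam z)) (λ q → ξlam (ξlam q)) (colon-step r _ _ _)

theorem4p10 : (bot : ℕ) (top : Ty) (s : Tm)
    → [] ⊢ s ∶ (top ⊃ top)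
    → (∀ G → (s · G) →β⁺ G)
    → (∀ {Γ t A} → Γ ⊢J t ∶ A → ctxBar bot top Γ ⊢ bar s t ∶ tyBar bot top A)
      × (∀ {t u} → t →J u → bar s t →β⁺ bar s u)
theorem4p10 bot top s s-⊢ s-shrinks = (λ d → bar-⊢ d id) , (λ r → bar-step r id)
  where
  open Typing bot top s (closed-weaken s-⊢)
  open Translation s (closed-sub s-⊢)
  open Simulation s-shrinks
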